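{- For all computations $M,L,N$ of $\lambda_{\copyright}$: (1) if $M\to^{\mathsf s}_\iota L\to^{\mathsf s}_{\beta_c} N$, then there is $P$ with $M\to^{\mathsf s}_{\beta_c}P\to^{\mathsf s}_\iota N$ or $M\to^{\mathsf s}_{\beta_c}P\to^{\mathsf s}_{\beta_c}N$; (2) if $M\to^{\mathsf s}_\iota L\to^{\mathsf s}_{\sigma} N$, then there is $P$ with $M(\to^{\mathsf s}_{\sigma})^+P\to^{\mathsf s}_\iota N$ or $M(\to^{\mathsf s}_{\sigma})^+P\to^{\mathsf s}_{\beta_c}N$.
   Context: The computational core $\lambda_{\copyright}$ has values $V,W ::= x \mid \lambda x.M$ and computations $M,N,L ::= \,!V \mid VM$ ($x$ ranging over a countable set of variables, terms up to $\alpha$-renaming). Rules: $\beta_c$: $(\lambda x.M)(!V) \mapsto M\{V/x\}$; $\sigma$: $(\lambda y.N)((\lambda x.M)L) \mapsto (\lambda x.(\lambda y.N)M)L$ provided $x\notin \mathrm{fv}(N)$; $\iota$: $(\lambda x.!x)M\mapsto M$ where $M$ is not of the form $!V$. Surface contexts $S ::= [\,]\mid VS\mid(\lambda x.S)M$; $\to^{\mathsf s}_\rho$ is the closure of rule $\rho$ under surface contexts; $^+$ is transitive closure. -}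

module Defs where

open import Data.Nat using (ℕ; zero; suc)
open import Data.Fin using (Fin; zero; suc)
open import Data.Product using (∃; _×_; _,_)
open import Data.Sum using (_⊎_)
open import Relation.Nullary using (¬_)
open import Relation.Binary.PropositionalEquality using (_≡_)

-- Well-scoped de Bruijn syntax of the computational core λ©
-- (terms up to α-renaming). Val n / Comp n: terms with free vars in Fin n.
mutual
  data Val (n : ℕ) : Set where
    var : Fin n → Val n
    lam : Comp (suc n) → Val n

  data Comp (n : ℕ) : Set where
    ret : Val n → Comp n             -- !V
    app : Val n → Comp n → Comp n

Ren : ℕ → ℕ → Set
Ren n m = Fin n → Fin m

extR : ∀ {n m} → Ren n m → Ren (suc n) (suc m)
extR ρ zero = zero
extR ρ (suc i) = suc (ρ i)

mutual
  renV : ∀ {n m} → Ren n m → Val n → Val m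
  renV ρ (var i) = var (ρ i)
  renV ρ (lam M) = lam (renC (extR ρ) M)

  renC : ∀ {n m} → Ren n m → Comp n → Comp m
  renC ρ (ret V) = ret (renV ρ V)
  renC ρ (app V M) = app (renV ρ V) (renC ρ M)

Sub : ℕ → ℕ → Set
Sub n m = Fin n → Val m

extS : ∀ {n m} → Sub n m → Sub (suc n) (suc m)
extS σ zero = var zero
extS σ (suc i) = renV suc (σ i)

mutual
  subV : ∀ {n m} → Sub n m → Val n → Val m
  subV σ (var i) = σ i
  subV σ (lam M) = lam (subC (extS σ) M)

  subC : ∀ {n m} → Sub n m → Comp n → Comp m
  subC σ (ret V) = ret (subV σ V)
  subC σ (app V M) = app (subV σ V) (subC σ M)

-- M{V/x} where x is the outermost bound variable (index 0)
single : ∀ {n} → Val n → Sub (suc n) n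
single V zero = V
single V (suc i) = var i

_[_] : ∀ {n} → Comp (suc n) → Val n → Comp n
M [ V ] = subC (single V) M

IsRet : ∀ {n} → Comp n → Set
IsRet {n} M = ∃ λ (V : Val n) → M ≡ ret V

data _↦βc_ {n : ℕ} : Comp n → Comp n → Set where
  βc : ∀ (M : Comp (suc n)) (V : Val n) → app (lam M) (ret V) ↦βc (M [ V ])

-- σ: (λy.N)((λx.M)L) ↦ (λx.(λy.N)M)L with x ∉ fv(N).
-- In de Bruijn form the side condition is built in: N (scope n+1, index 0 = y)
-- is weakened to skip the new binder x (index 1 under y), i.e. renamed by extR suc.
data _↦σ_ {n : ℕ} : Comp n → Comp n → Set where
  σr : ∀ (N : Comp (suc n)) (M : Comp (suc n)) (L : Comp n) →
       app (lam N) (app (lam M) L) ↦σ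
       app (lam (app (lam (renC (extR suc) N)) M)) L

data _↦ι_ {n : ℕ} : Comp n → Comp n → Set where
  ιr : ∀ (M : Comp n) → ¬ IsRet M → app (lam (ret (var zero))) M ↦ι M

-- Closure under surface contexts S ::= [] | V S | (λx.S) M
Rel : Set₁
Rel = ∀ {n} → Comp n → Comp n → Set

data Surf (R : Rel) {n : ℕ} : Comp n → Comp n → Set where
  root : ∀ {M N} → R M N → Surf R M N
  appR : ∀ (V : Val n) {M N} → Surf R M N → Surf R (app V M) (app V N)
  lamL : ∀ {S S' : Comp (suc n)} (M : Comp n) → Surf R S S' →
         Surf R (app (lam S) M) (app (lam S') M)

_→sβc_ _→sσ_ _→sι_ : ∀ {n} → Comp n → Comp n → Set
_→sβc_ = Surf _↦βc_
_→sσ_ = Surf _↦σ_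
_→sι_ = Surf _↦ι_

data Plus {n : ℕ} (R : Comp n → Comp n → Set) : Comp n → Comp n → Set where
  [_] : ∀ {M N} → R M N → Plus R M N
  _∷_ : ∀ {M N P} → R M N → Plus R N P → Plus R M P

-- Steps in disjoint positions simply commute. When the ι-redex (λx.!x)M is
-- at the root the next step happens inside M; we perform it first and then
-- contract with ι, or with βc if M has become a value !V (ι does not apply
-- to values). The one genuine overlap is an ι-redex sitting in the argument
-- of a σ-redex, (λy.N)((λx.!x)((λz.M)L)): two σ-steps move the ι-redex to
-- the position (λy.N)(!x), where it is a βc-redex whose contractum N{x/y}
-- is the σ-reduct, since x is fresh for N.
module Submission where

open import Defs
open import Data.Nat using (ℕ; suc)
open import Data.Fin using (zero; suc)
open import Data.Product using (∃; _×_; _,_)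
open import Data.Sum using (_⊎_; inj₁; inj₂)
open import Function using (_∘_)
open import Relation.Nullary using (¬_)
open import Relation.Binary.PropositionalEquality
  using (_≡_; _≗_; refl; cong; cong₂; subst; subst₂; module ≡-Reasoning)

mutual
  subV-renV : ∀ {n m k} (σ : Sub m k) (ρ : Ren n m) (τ : Sub n k) →
    σ ∘ ρ ≗ τ → subV σ ∘ renV ρ ≗ subV τ
  subV-renV σ ρ τ eq (var i) = eq i
  subV-renV σ ρ τ eq (lam M) = cong lam (subC-renC (extS σ) (extR ρ) (extS τ) ext-eq M)
    where
    ext-eq : extS σ ∘ extR ρ ≗ extS τ
    ext-eq zero = refl
    ext-eq (suc i) = cong (renV suc) (eq i)

  subC-renC : ∀ {n m k} (σ : Sub m k) (ρ : Ren n m) (τ : Sub n k) →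
    σ ∘ ρ ≗ τ → subC σ ∘ renC ρ ≗ subC τ
  subC-renC σ ρ τ eq (ret V) = cong ret (subV-renV σ ρ τ eq V)
  subC-renC σ ρ τ eq (app V M) = cong₂ app (subV-renV σ ρ τ eq V) (subC-renC σ ρ τ eq M)

mutual
  subV-var : ∀ {n k} (τ : Sub n k) (ρ : Ren n k) → τ ≗ var ∘ ρ → subV τ ≗ renV ρ
  subV-var τ ρ eq (var i) = eq i
  subV-var τ ρ eq (lam M) = cong lam (subC-var (extS τ) (extR ρ) ext-eq M)
    where
    ext-eq : extS τ ≗ var ∘ extR ρ
    ext-eq zero = refl
    ext-eq (suc i) = cong (renV suc) (eq i)

  subC-var : ∀ {n k} (τ : Sub n k) (ρ : Ren n k) → τ ≗ var ∘ ρ → subC τ ≗ renC ρ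
  subC-var τ ρ eq (ret V) = cong ret (subV-var τ ρ eq V)
  subC-var τ ρ eq (app V M) = cong₂ app (subV-var τ ρ eq V) (subC-var τ ρ eq M)

-- The βc-contractum arising in the σ/ι overlap: y is substituted by x in a
-- body that was weakened so as not to see x.
weaken-twice-[var₀] : ∀ {n} (N : Comp (suc n)) →
  subC (single (var zero)) (renC (extR (extR suc)) (renC (extR suc) N)) ≡ renC (extR suc) N
weaken-twice-[var₀] N = begin
    subC (single (var zero)) (renC (extR (extR suc)) (renC (extR suc) N))
  ≡⟨ subC-renC _ _ _ (λ _ → refl) (renC (extR suc) N) ⟩
    subC (single (var zero) ∘ extR (extR suc)) (renC (extR suc) N)
  ≡⟨ subC-renC _ _ _ (λ _ → refl) N ⟩
    subC (single (var zero) ∘ extR (extR suc) ∘ extR suc) N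
  ≡⟨ subC-var _ (extR suc) var-eq N ⟩
    renC (extR suc) N
  ∎
  where
  open ≡-Reasoning
  var-eq : single (var zero) ∘ extR (extR suc) ∘ extR suc ≗ var ∘ extR suc
  var-eq zero = refl
  var-eq (suc i) = refl

isRet? : ∀ {n} (M : Comp n) → IsRet M ⊎ ¬ IsRet M
isRet? (ret V) = inj₁ (V , refl)
isRet? (app V M) = inj₂ λ { (_ , ()) }

¬IsRet-subC : ∀ {n m} (σ : Sub n m) {M : Comp n} → ¬ IsRet M → ¬ IsRet (subC σ M)
¬IsRet-subC σ {ret V} ¬ret = λ _ → ¬ret (V , refl)
¬IsRet-subC σ {app V M} ¬ret = λ { (_ , ()) }

↦ι-subC : ∀ {n m} (σ : Sub n m) {M N : Comp n} → M ↦ι N → subC σ M ↦ι subC σ N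
↦ι-subC σ (ιr M ¬ret) = ιr (subC σ M) (¬IsRet-subC σ ¬ret)

Surf-subC : ∀ {R : Rel} →
  (∀ {n m} (σ : Sub n m) {M N : Comp n} → R M N → R (subC σ M) (subC σ N)) →
  ∀ {n m} (σ : Sub n m) {M N : Comp n} → Surf R M N → Surf R (subC σ M) (subC σ N)
Surf-subC R-subC σ (root r) = root (R-subC σ r)
Surf-subC R-subC σ (appR V s) = appR (subV σ V) (Surf-subC R-subC σ s)
Surf-subC R-subC σ (lamL M s) = lamL (subC σ M) (Surf-subC R-subC (extS σ) s)

→sι-subC : ∀ {n m} (σ : Sub n m) {M N : Comp n} → M →sι N → subC σ M →sι subC σ N
→sι-subC = Surf-subC ↦ι-subC

→sι-renC : ∀ {n m} (ρ : Ren n m) {M N : Comp n} → M →sι N → renC ρ M →sι renC ρ N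
→sι-renC ρ {M} {N} s =
  subst₂ _→sι_ (subC-var (var ∘ ρ) ρ (λ _ → refl) M) (subC-var (var ∘ ρ) ρ (λ _ → refl) N)
    (→sι-subC (var ∘ ρ) s)

¬→sι-ret : ∀ {n} {M : Comp n} {V : Val n} → ¬ (M →sι ret V)
¬→sι-ret (root (ιr _ ¬ret)) = ¬ret (_ , refl)

→sσ-¬IsRet : ∀ {n} {M N : Comp n} → M →sσ N → ¬ IsRet N
→sσ-¬IsRet (root (σr _ _ _)) (_ , ())
→sσ-¬IsRet (appR _ _) (_ , ())
→sσ-¬IsRet (lamL _ _) (_ , ())

Plus-map : ∀ {n m} {R : Comp n → Comp n → Set} {R′ : Comp m → Comp m → Set}
  (f : Comp n → Comp m) → (∀ {M N} → R M N → R′ (f M) (f N)) →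
  ∀ {M N} → Plus R M N → Plus R′ (f M) (f N)
Plus-map f F [ r ] = [ F r ]
Plus-map f F (r ∷ rs) = F r ∷ Plus-map f F rs

SurfCongruence : ∀ {n m} → (Comp n → Comp m) → Set₁
SurfCongruence f = ∀ {R : Rel} {M N} → Surf R M N → Surf R (f M) (f N)

ιβc-Postponed : ∀ {n} → Comp n → Comp n → Set
ιβc-Postponed M N = ∃ λ P → ((M →sβc P) × (P →sι N)) ⊎ ((M →sβc P) × (P →sβc N))

ισ-Postponed : ∀ {n} → Comp n → Comp n → Set
ισ-Postponed M N =
  ∃ λ P → ((Plus _→sσ_ M P) × (P →sι N)) ⊎ ((Plus _→sσ_ M P) × (P →sβc N))

ιβc-Postponed-cong : ∀ {n m} (f : Comp n → Comp m) → SurfCongruence f →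
  ∀ {M N} → ιβc-Postponed M N → ιβc-Postponed (f M) (f N)
ιβc-Postponed-cong f F (P , inj₁ (a , b)) = f P , inj₁ (F a , F b)
ιβc-Postponed-cong f F (P , inj₂ (a , b)) = f P , inj₂ (F a , F b)

ισ-Postponed-cong : ∀ {n m} (f : Comp n → Comp m) → SurfCongruence f →
  ∀ {M N} → ισ-Postponed M N → ισ-Postponed (f M) (f N)
ισ-Postponed-cong f F (P , inj₁ (a , b)) = f P , inj₁ (Plus-map f F a , F b)
ισ-Postponed-cong f F (P , inj₂ (a , b)) = f P , inj₂ (Plus-map f F a , F b)

ι-βc-postpone : ∀ {n} {M L N : Comp n} → M →sι L → L →sβc N → ιβc-Postponed M N
ι-βc-postpone {N = N} (root (ιr _ _)) t with isRet? N
... | inj₁ (V , refl) = _ , inj₂ (appR _ t , root (βc _ V))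
... | inj₂ ¬ret = _ , inj₁ (appR _ t , root (ιr N ¬ret))
ι-βc-postpone (appR V s) (root (βc _ _)) with () ← ¬→sι-ret s
ι-βc-postpone (appR V s) (appR _ t) = ιβc-Postponed-cong (app V) (appR V) (ι-βc-postpone s t)
ι-βc-postpone (appR _ s) (lamL _ t) = _ , inj₁ (lamL _ t , appR _ s)
ι-βc-postpone (lamL {S = S} _ s) (root (βc _ W)) = _ , inj₁ (root (βc S W) , →sι-subC (single W) s)
ι-βc-postpone (lamL _ s) (appR _ t) = _ , inj₁ (appR _ t , lamL _ s)
ι-βc-postpone (lamL K s) (lamL _ t) =
  ιβc-Postponed-cong (λ S → app (lam S) K) (lamL K) (ι-βc-postpone s t)

ι-σ-postpone : ∀ {n} {M L N : Comp n} → M →sι L → L →sσ N → ισ-Postponed M N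
ι-σ-postpone {N = N} (root (ιr _ _)) t = _ , inj₁ ([ appR _ t ] , root (ιr N (→sσ-¬IsRet t)))
ι-σ-postpone (appR (lam N) (root (ιr _ _))) (root (σr _ M L)) =
  _ , inj₂ (root (σr N (ret (var zero)) (app (lam M) L)) ∷ [ root (σr Nx M L) ] , contract)
  where
  Nx : Comp _
  Nx = app (lam (renC (extR suc) N)) (ret (var zero))
  under-lams : Comp _ → Comp _
  under-lams X = app (lam (app (lam X) M)) L
  contract : under-lams (renC (extR suc) Nx) →sβc under-lams (renC (extR suc) N)
  contract = subst (λ X → under-lams (renC (extR suc) Nx) →sβc under-lams X)
    (weaken-twice-[var₀] N) (lamL L (lamL M (root (βc _ (var zero)))))
ι-σ-postpone (appR (lam N) (appR _ s)) (root (σr _ M _)) = _ , inj₁ ([ root (σr N M _) ] , appR _ s)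
ι-σ-postpone (appR (lam N) (lamL {S = S} L s)) (root (σr _ _ _)) =
  _ , inj₁ ([ root (σr N S L) ] , lamL L (appR _ s))
ι-σ-postpone (appR V s) (appR _ t) = ισ-Postponed-cong (app V) (appR V) (ι-σ-postpone s t)
ι-σ-postpone (appR _ s) (lamL _ t) = _ , inj₁ ([ lamL _ t ] , appR _ s)
ι-σ-postpone (lamL {S = S} _ s) (root (σr _ M L)) =
  _ , inj₁ ([ root (σr S M L) ] , lamL L (lamL M (→sι-renC (extR suc) s)))
ι-σ-postpone (lamL _ s) (appR _ t) = _ , inj₁ ([ appR _ t ] , lamL _ s)
ι-σ-postpone (lamL K s) (lamL _ t) =
  ισ-Postponed-cong (λ S → app (lam S) K) (lamL K) (ι-σ-postpone s t)

mainTheorem19 : ∀ {n : ℕ} (M L N : Comp n) →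
    ((M →sι L) → (L →sβc N) →
    ∃ λ P → ((M →sβc P) × (P →sι N)) ⊎ ((M →sβc P) × (P →sβc N)))
    × ((M →sι L) → (L →sσ N) →
    ∃ λ P → ((Plus _→sσ_ M P) × (P →sι N)) ⊎ ((Plus _→sσ_ M P) × (P →sβc N)))
mainTheorem19 M L N = ι-βc-postpone , ι-σ-postpone
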